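{- Let $T$ and $B$ be lattice paths with steps $N=(0,1)$ and $E=(1,0)$ from the origin to $(x,y)\in\mathbb N^2$, with $T$ weakly above $B$, let $\mathcal D\subset\mathbb N$ and let $\mathbf H$ be a finite sequence of integers. Then $\widetilde{\mathcal P}(T,B,\mathcal D,\mathbf H)$ contains at most one path $P_1$ with $t(P_1)=1$ and $b(P_1)=0$, and at most one path $P_2$ with $t(P_2)=0$ and $b(P_2)=1$.
   Context: $T$ weakly above $B$ means no point of $T$ is strictly below or strictly to the right of $B$. $\widetilde{\mathcal P}(T,B)$ is the set of self-avoiding lattice paths from the origin to $(x,y)$ with steps $N=(0,1)$, $E=(1,0)$, $S=(0,-1)$ lying weakly below $T$ and weakly above $B$; the descent set of such a path is the set of $x$-coordinates at which its south steps occur. A top (bottom) contact is an east step of the path that is also a step of $T$ (of $B$); $t(P)$, $b(P)$ are their numbers. $\widetilde{\mathcal P}(T,B,\mathcal D,\mathbf H)$ is the set of $P\in\widetilde{\mathcal P}(T,B)$ with descent set $\mathcal D$ whose left-to-right sequence of $y$-coordinates of east steps that are neither top nor bottom contacts equals $\mathbf H$. -}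

module Defs where

open import Data.Nat using (ℕ)
open import Data.Integer as ℤ using (ℤ; +_; _≤_)
open import Data.Product using (_×_; _,_; proj₁; proj₂)
open import Data.Product.Properties using (≡-dec)
open import Data.List using (List; []; _∷_; length; filter; map; scanl; foldl)
open import Data.List.Relation.Unary.All using (All)
open import Data.List.Relation.Unary.Any using (Any)
open import Data.List.Relation.Unary.Unique.Propositional using (Unique)
open import Data.List.Membership.Propositional using (_∈_)
open import Relation.Binary.PropositionalEquality using (_≡_; _≢_)
open import Relation.Nullary using (¬_; Dec)
open import Relation.Nullary.Decidable using (¬?; _×-dec_)
open import Relation.Unary using (Pred)
open import Function.Bundles using (_⇔_)
open import Level using (0ℓ)

Point : Set
Point = ℤ × ℤ

_≟ₚ_ : (p q : Point) → Dec (p ≡ q)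
_≟ₚ_ = ≡-dec ℤ._≟_ ℤ._≟_

open import Data.List.Membership.DecPropositional _≟ₚ_ using (_∈?_)

origin : Point
origin = (+ 0 , + 0)

data Step : Set where
  N E S : Step

move : Point → Step → Point
move (a , b) N = (a , b ℤ.+ + 1)
move (a , b) E = (a ℤ.+ + 1 , b)
move (a , b) S = (a , b ℤ.- + 1)

-- A path is its list of steps, starting at the origin.
Path : Set
Path = List Step

points : Path → List Point
points = scanl move origin

endpoint : Path → Point
endpoint = foldl move origin

NEPath : Path → Set
NEPath P = All (λ s → s ≢ S) P

SelfAvoiding : Path → Set
SelfAvoiding P = Unique (points P)

eastFrom : Point → Path → List Point
eastFrom p [] = []
eastFrom p (N ∷ s) = eastFrom (move p N) s
eastFrom p (E ∷ s) = p ∷ eastFrom (move p E) s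
eastFrom p (S ∷ s) = eastFrom (move p S) s

southFrom : Point → Path → List Point
southFrom p [] = []
southFrom p (N ∷ s) = southFrom (move p N) s
southFrom p (E ∷ s) = southFrom (move p E) s
southFrom p (S ∷ s) = p ∷ southFrom (move p S) s

eastSteps : Path → List Point
eastSteps = eastFrom origin

southSteps : Path → List Point
southSteps = southFrom origin

-- A point p is weakly above (a monotone NE path) Q: it is neither strictly
-- below Q (some point of Q in its column is weakly below it) nor strictly to
-- the right of Q (some point of Q in its row is weakly to its right).
WeaklyAbovePt : Point → Path → Set
WeaklyAbovePt (a , b) Q =
  Any (λ q → proj₁ q ≡ a × proj₂ q ≤ b) (points Q) ×
  Any (λ q → proj₂ q ≡ b × a ≤ proj₁ q) (points Q)

-- Mirror notion: p is weakly below Q (not strictly above, not strictly left).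
WeaklyBelowPt : Point → Path → Set
WeaklyBelowPt (a , b) Q =
  Any (λ q → proj₁ q ≡ a × b ≤ proj₂ q) (points Q) ×
  Any (λ q → proj₂ q ≡ b × proj₁ q ≤ a) (points Q)

WeaklyAbove : Path → Path → Set
WeaklyAbove T B = All (λ p → WeaklyAbovePt p B) (points T)

t : Path → Path → ℕ
t T P = length (filter (λ p → p ∈? eastSteps T) (eastSteps P))

b : Path → Path → ℕ
b B P = length (filter (λ p → p ∈? eastSteps B) (eastSteps P))

InP̃ : Path → Path → ℕ → ℕ → Path → Set
InP̃ T B x y P =
  endpoint P ≡ (+ x , + y) ×
  SelfAvoiding P ×
  All (λ p → WeaklyBelowPt p T × WeaklyAbovePt p B) (points P)

HasDescentSet : Path → Pred ℕ 0ℓ → Set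
HasDescentSet P D = (k : ℕ) → ((+ k) ∈ map proj₁ (southSteps P)) ⇔ D k

heights : Path → Path → Path → List ℤ
heights T B P =
  map proj₂ (filter (λ p → ¬? (p ∈? eastSteps T) ×-dec ¬? (p ∈? eastSteps B)) (eastSteps P))

InP̃DH : Path → Path → ℕ → ℕ → Pred ℕ 0ℓ → List ℤ → Path → Set
InP̃DH T B x y D H P = InP̃ T B x y P × HasDescentSet P D × heights T B P ≡ H

-- Two paths of P̃(T,B,D,H) with the same contact counts are compared column by column; each
-- has exactly one east step per column, and a self-avoiding path is determined by its east
-- steps and endpoint. Where both east steps are free (no contact) their heights are read off
-- H in the same order, so they agree; two top contacts in the same column coincide. If P has
-- its unique top contact in a column where Q is free, Q lies strictly below it, and from then
-- on P's free heights lag one column behind Q's. Equal descent sets then keep Q strictly below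
-- P column after column, so Q never reaches T for its own top contact. For bottom contacts Q
-- stays weakly above P instead, and Q's bottom contact would have to be one of P's free steps.

module Submission where

open import Defs
open import Data.Nat using (ℕ; s≤s; z≤n)
open import Data.Nat.Properties using (suc-injective)
open import Data.Integer using (ℤ; +_; -[1+_]; _+_; _-_; -_; _≤_; _≥_; _<_; -<+; +<+)
import Data.Integer.Properties as ℤP
open import Data.Product using (_×_; _,_; proj₁; proj₂; swap)
open import Data.Sum using (_⊎_; inj₁; inj₂)
open import Data.Unit using (⊤; tt)
open import Data.Empty using (⊥; ⊥-elim)
open import Data.Maybe using (fromMaybe)
open import Data.List using (List; []; _∷_; length; filter; map; scanl; foldl; head)
open import Data.List.Properties using (∷-injective; filter-accept; filter-reject; filter-all; filter-≐)
open import Data.List.Relation.Unary.All as All using (All; []; _∷_)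
open import Data.List.Relation.Unary.Linked as Linked using (Linked; []; [-]; _∷_)
open import Data.List.Relation.Unary.Unique.Propositional using (Unique)
open import Data.List.Relation.Unary.AllPairs using ([]; _∷_)
open import Data.List.Membership.Propositional using (_∈_; _∉_; find)
open import Data.List.Membership.DecPropositional _≟ₚ_ using (_∈?_)
open import Data.List.Relation.Unary.Any using (here; there)
open import Relation.Binary.PropositionalEquality using (_≡_; _≢_; refl; sym; trans; cong; cong₂; subst; module ≡-Reasoning)
open import Relation.Nullary using (¬_; yes; no)
open import Relation.Nullary.Decidable using (¬?; _×-dec_)
open import Relation.Unary using (Pred; Decidable; ∁)
open import Function using (flip)
open import Function.Bundles using (_⇔_; mk⇔; Equivalence)
import Function.Properties.Equivalence as ⇔
open import Level using (0ℓ)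

open Equivalence using (to; from)

i<i+1 : ∀ i → i < i + + 1
i<i+1 i = subst (_< i + + 1) (ℤP.+-identityʳ i) (ℤP.+-monoʳ-< i (+<+ (s≤s z≤n)))

i-1<i : ∀ i → i - + 1 < i
i-1<i i = subst (i - + 1 <_) (ℤP.+-identityʳ i) (ℤP.+-monoʳ-< i -<+)

i+1-1≡i : ∀ i → i + + 1 - + 1 ≡ i
i+1-1≡i i = trans (ℤP.+-assoc i (+ 1) (- + 1)) (ℤP.+-identityʳ i)

i-1+1≡i : ∀ i → i - + 1 + + 1 ≡ i
i-1+1≡i i = trans (ℤP.+-assoc i (- + 1) (+ 1)) (ℤP.+-identityʳ i)

start∈scanl : ∀ p P → p ∈ scanl move p P
start∈scanl p []      = here refl
start∈scanl p (_ ∷ _) = here refl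

foldl∈scanl : ∀ p P → foldl move p P ∈ scanl move p P
foldl∈scanl p []      = here refl
foldl∈scanl p (s ∷ P) = there (foldl∈scanl (move p s) P)

eastFrom⊆scanl : ∀ p P {e} → e ∈ eastFrom p P → e ∈ scanl move p P
eastFrom⊆scanl p (N ∷ P) e∈         = there (eastFrom⊆scanl (move p N) P e∈)
eastFrom⊆scanl p (E ∷ P) (here e≡p) = here e≡p
eastFrom⊆scanl p (E ∷ P) (there e∈) = there (eastFrom⊆scanl (move p E) P e∈)
eastFrom⊆scanl p (S ∷ P) e∈         = there (eastFrom⊆scanl (move p S) P e∈)

move-E-eastFrom∈scanl : ∀ p P {e} → e ∈ eastFrom p P → move e E ∈ scanl move p P
move-E-eastFrom∈scanl p (N ∷ P) e∈          = there (move-E-eastFrom∈scanl (move p N) P e∈)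
move-E-eastFrom∈scanl p (E ∷ P) (here refl) = there (start∈scanl (move p E) P)
move-E-eastFrom∈scanl p (E ∷ P) (there e∈)  = there (move-E-eastFrom∈scanl (move p E) P e∈)
move-E-eastFrom∈scanl p (S ∷ P) e∈          = there (move-E-eastFrom∈scanl (move p S) P e∈)

start∉scanl-tail : ∀ p s P → Unique (scanl move p (s ∷ P)) → p ∉ scanl move (move p s) P
start∉scanl-tail p s P (p≢ ∷ _) p∈ = All.lookup p≢ p∈ refl

start∉eastFrom : ∀ p s P → Unique (scanl move p (s ∷ P)) → p ∉ eastFrom (move p s) P
start∉eastFrom p s P u p∈ = start∉scanl-tail p s P u (eastFrom⊆scanl (move p s) P p∈)

∷≡⇒∈ : ∀ {p : Point} {ps qs} → p ∷ ps ≡ qs → p ∈ qs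
∷≡⇒∈ refl = here refl

data UTurn : Step → Step → Set where
  NS : UTurn N S
  SN : UTurn S N

NoUTurns : Path → Set
NoUTurns = Linked (λ s s′ → ¬ UTurn s s′)

selfAvoiding⇒noUTurns : ∀ p P → Unique (scanl move p P) → NoUTurns P
selfAvoiding⇒noUTurns p       []           _ = []
selfAvoiding⇒noUTurns p       (_ ∷ [])     _ = [-]
selfAvoiding⇒noUTurns (a , b) (s ∷ s′ ∷ P) ((_ ∷ p≢ ∷ _) ∷ u) =
  (λ turn → p≢ (sym (returns turn))) ∷ selfAvoiding⇒noUTurns (move (a , b) s) (s′ ∷ P) u
  where
  returns : ∀ {s s′} → UTurn s s′ → move (move (a , b) s) s′ ≡ (a , b)
  returns NS = cong (a ,_) (i+1-1≡i b)
  returns SN = cong (a ,_) (i-1+1≡i b)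

runEnd : Point → Path → Point
runEnd p P = fromMaybe (foldl move p P) (head (eastFrom p P))

runEnd-cong : ∀ p P Q → eastFrom p P ≡ eastFrom p Q → foldl move p P ≡ foldl move p Q → runEnd p P ≡ runEnd p Q
runEnd-cong p P Q east end = cong₂ (λ es e → fromMaybe e (head es)) east end

runEnd-climbs : ∀ p P → NoUTurns (N ∷ P) → proj₂ p ≤ proj₂ (runEnd p P)
runEnd-climbs p       []      _          = ℤP.≤-refl
runEnd-climbs p       (E ∷ P) _          = ℤP.≤-refl
runEnd-climbs (a , b) (N ∷ P) (_ ∷ nu)   = ℤP.≤-trans (ℤP.i≤i+j b (+ 1)) (runEnd-climbs (a , b + + 1) P nu)
runEnd-climbs p       (S ∷ P) (¬ns ∷ _) = ⊥-elim (¬ns NS)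

runEnd-descends : ∀ p P → NoUTurns (S ∷ P) → proj₂ (runEnd p P) ≤ proj₂ p
runEnd-descends p       []      _          = ℤP.≤-refl
runEnd-descends p       (E ∷ P) _          = ℤP.≤-refl
runEnd-descends p       (N ∷ P) (¬sn ∷ _) = ⊥-elim (¬sn SN)
runEnd-descends (a , b) (S ∷ P) (_ ∷ nu)   = ℤP.≤-trans (runEnd-descends (a , b - + 1) P nu) (ℤP.i-j≤i b (+ 1))

runEnd-N≢S : ∀ a b P Q → NoUTurns (N ∷ P) → NoUTurns (S ∷ Q) → runEnd (a , b + + 1) P ≢ runEnd (a , b - + 1) Q
runEnd-N≢S a b P Q nuP nuQ same = ℤP.<-irrefl refl (begin-strict
  b                                ≤⟨ ℤP.<⇒≤ (i<i+1 b) ⟩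
  b + + 1                          ≤⟨ runEnd-climbs (a , b + + 1) P nuP ⟩
  proj₂ (runEnd (a , b + + 1) P)   ≡⟨ cong proj₂ same ⟩
  proj₂ (runEnd (a , b - + 1) Q)   ≤⟨ runEnd-descends (a , b - + 1) Q nuQ ⟩
  b - + 1                          <⟨ i-1<i b ⟩
  b                                ∎)
  where open ℤP.≤-Reasoning

-- Between consecutive east steps a self-avoiding path runs straight up or straight down,
-- so the east steps and the endpoint pin down every vertical run.
eastFrom-foldl-injective : ∀ p P Q → Unique (scanl move p P) → Unique (scanl move p Q) →
                           eastFrom p P ≡ eastFrom p Q → foldl move p P ≡ foldl move p Q → P ≡ Q
eastFrom-foldl-injective p [] [] _ _ _ _ = refl
eastFrom-foldl-injective p [] (s ∷ Q) _ uQ _ end =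
  ⊥-elim (start∉scanl-tail p s Q uQ (subst (_∈ scanl move (move p s) Q) (sym end) (foldl∈scanl (move p s) Q)))
eastFrom-foldl-injective p (s ∷ P) [] uP _ _ end =
  ⊥-elim (start∉scanl-tail p s P uP (subst (_∈ scanl move (move p s) P) end (foldl∈scanl (move p s) P)))
eastFrom-foldl-injective p (E ∷ P) (E ∷ Q) (_ ∷ uP) (_ ∷ uQ) east end =
  cong (E ∷_) (eastFrom-foldl-injective (move p E) P Q uP uQ (proj₂ (∷-injective east)) end)
eastFrom-foldl-injective p (N ∷ P) (N ∷ Q) (_ ∷ uP) (_ ∷ uQ) east end =
  cong (N ∷_) (eastFrom-foldl-injective (move p N) P Q uP uQ east end)
eastFrom-foldl-injective p (S ∷ P) (S ∷ Q) (_ ∷ uP) (_ ∷ uQ) east end =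
  cong (S ∷_) (eastFrom-foldl-injective (move p S) P Q uP uQ east end)
eastFrom-foldl-injective p (E ∷ P) (N ∷ Q) _  uQ east _ = ⊥-elim (start∉eastFrom p N Q uQ (∷≡⇒∈ east))
eastFrom-foldl-injective p (E ∷ P) (S ∷ Q) _  uQ east _ = ⊥-elim (start∉eastFrom p S Q uQ (∷≡⇒∈ east))
eastFrom-foldl-injective p (N ∷ P) (E ∷ Q) uP _  east _ = ⊥-elim (start∉eastFrom p N P uP (∷≡⇒∈ (sym east)))
eastFrom-foldl-injective p (S ∷ P) (E ∷ Q) uP _  east _ = ⊥-elim (start∉eastFrom p S P uP (∷≡⇒∈ (sym east)))
eastFrom-foldl-injective (a , b) (N ∷ P) (S ∷ Q) uP uQ east end =
  ⊥-elim (runEnd-N≢S a b P Q (selfAvoiding⇒noUTurns _ (N ∷ P) uP) (selfAvoiding⇒noUTurns _ (S ∷ Q) uQ)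
            (runEnd-cong (a , b) (N ∷ P) (S ∷ Q) east end))
eastFrom-foldl-injective (a , b) (S ∷ P) (N ∷ Q) uP uQ east end =
  ⊥-elim (runEnd-N≢S a b Q P (selfAvoiding⇒noUTurns _ (N ∷ Q) uQ) (selfAvoiding⇒noUTurns _ (S ∷ P) uP)
            (runEnd-cong (a , b) (N ∷ Q) (S ∷ P) (sym east) (sym end)))

NEPath-monotone : ∀ p P → NEPath P → ∀ {r} → r ∈ scanl move p P → proj₁ p ≤ proj₁ r × proj₂ p ≤ proj₂ r
NEPath-monotone p       P       _          (here refl) = ℤP.≤-refl , ℤP.≤-refl
NEPath-monotone (a , b) (N ∷ P) (_ ∷ ne)   (there r∈)  =
  let a≤ , b+1≤ = NEPath-monotone (a , b + + 1) P ne r∈ in a≤ , ℤP.≤-trans (ℤP.i≤i+j b (+ 1)) b+1≤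
NEPath-monotone (a , b) (E ∷ P) (_ ∷ ne)   (there r∈)  =
  let a+1≤ , b≤ = NEPath-monotone (a + + 1 , b) P ne r∈ in ℤP.≤-trans (ℤP.i≤i+j a (+ 1)) a+1≤ , b≤
NEPath-monotone p       (S ∷ P) (¬S ∷ _)   (there _)   = ⊥-elim (¬S refl)

NEPath-eastStep-splits : ∀ p P → NEPath P → ∀ {e r} → e ∈ eastFrom p P → r ∈ scanl move p P →
  (proj₁ r ≤ proj₁ e × proj₂ r ≤ proj₂ e) ⊎ (proj₁ e < proj₁ r × proj₂ e ≤ proj₂ r)
NEPath-eastStep-splits p P ne e∈ (here refl) = inj₁ (NEPath-monotone p P ne (eastFrom⊆scanl p P e∈))
NEPath-eastStep-splits p (N ∷ P) (_ ∷ ne) e∈ (there r∈) = NEPath-eastStep-splits (move p N) P ne e∈ r∈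
NEPath-eastStep-splits (a , b) (E ∷ P) (_ ∷ ne) (here refl) (there r∈) =
  let a+1≤ , b≤ = NEPath-monotone (a + + 1 , b) P ne r∈ in inj₂ (ℤP.<-≤-trans (i<i+1 a) a+1≤ , b≤)
NEPath-eastStep-splits p (E ∷ P) (_ ∷ ne) (there e∈) (there r∈) = NEPath-eastStep-splits (move p E) P ne e∈ r∈
NEPath-eastStep-splits p (S ∷ P) (¬S ∷ _) _ (there _) = ⊥-elim (¬S refl)

NEPath-column≤eastStep : ∀ p P → NEPath P → ∀ {e r} → e ∈ eastFrom p P → r ∈ scanl move p P →
                         proj₁ r ≡ proj₁ e → proj₂ r ≤ proj₂ e
NEPath-column≤eastStep p P ne e∈ r∈ same with NEPath-eastStep-splits p P ne e∈ r∈
... | inj₁ (_ , r≤e)  = r≤e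
... | inj₂ (e<r , _) = ⊥-elim (ℤP.<-irrefl (sym same) e<r)

NEPath-eastStep≤nextColumn : ∀ p P → NEPath P → ∀ {e r} → e ∈ eastFrom p P → r ∈ scanl move p P →
                             proj₁ r ≡ proj₁ e + + 1 → proj₂ e ≤ proj₂ r
NEPath-eastStep≤nextColumn p P ne {e} e∈ r∈ next with NEPath-eastStep-splits p P ne e∈ r∈
... | inj₁ (r≤e , _) = ⊥-elim (ℤP.<⇒≱ (i<i+1 (proj₁ e)) (subst (_≤ proj₁ e) next r≤e))
... | inj₂ (_ , e≤r) = e≤r

-- How the east steps see the descent set: a south step occurs in column z exactly when the
-- east step there lies below the previous one (below h for the first).
DescentProfile : (ℤ → Set) → ℤ → ℤ → List Point → Set
DescentProfile Sp z h []       = ⊤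
DescentProfile Sp z h (p ∷ xs) =
  proj₁ p ≡ z × (Sp z ⇔ proj₂ p < h) × DescentProfile Sp (z + + 1) (proj₂ p) xs

DescentProfile-resp : ∀ {Sp Sp′} → (∀ z → Sp z ⇔ Sp′ z) →
                      ∀ {z h} xs → DescentProfile Sp z h xs → DescentProfile Sp′ z h xs
DescentProfile-resp Sp⇔ []       tt                    = tt
DescentProfile-resp Sp⇔ (_ ∷ xs) (column , drop , rest) =
  column , ⇔.trans (⇔.sym (Sp⇔ _)) drop , DescentProfile-resp Sp⇔ xs rest

DescentProfile-heights-injective : ∀ {Sp Sp′ z h h′} xs ys →
  DescentProfile Sp z h xs → DescentProfile Sp′ z h′ ys → map proj₂ xs ≡ map proj₂ ys → xs ≡ ys
DescentProfile-heights-injective []       []       _               _               _       = refl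
DescentProfile-heights-injective (p ∷ xs) (q ∷ ys) (colp , _ , px) (colq , _ , qy) heights =
  let same-height , rest = ∷-injective heights in
  cong₂ _∷_ (cong₂ _,_ (trans colp (sym colq)) same-height)
            (DescentProfile-heights-injective xs ys px qy rest)

southCols : Point → Path → List ℤ
southCols p P = map proj₁ (southFrom p P)

southCols-≥ : ∀ p P {z} → z ∈ southCols p P → proj₁ p ≤ z
southCols-≥ p       (N ∷ P) z∈         = southCols-≥ (move p N) P z∈
southCols-≥ (a , b) (E ∷ P) z∈         = ℤP.≤-trans (ℤP.i≤i+j a (+ 1)) (southCols-≥ (a + + 1 , b) P z∈)
southCols-≥ p       (S ∷ P) (here z≡)  = ℤP.≤-reflexive (sym z≡)
southCols-≥ p       (S ∷ P) (there z∈) = southCols-≥ (move p S) P z∈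

southCols-climbing : ∀ a b P → NoUTurns (N ∷ P) → a ∉ southCols (a , b) P
southCols-climbing a b (N ∷ P) (_ ∷ nu) a∈ = southCols-climbing a (b + + 1) P nu a∈
southCols-climbing a b (E ∷ P) _        a∈ = ℤP.<⇒≱ (i<i+1 a) (southCols-≥ (a + + 1 , b) P a∈)
southCols-climbing a b (S ∷ P) (¬ns ∷ _) _ = ¬ns NS

runEnd-south⇔ : ∀ a b P → NoUTurns P → (a ∈ southCols (a , b) P ⇔ proj₂ (runEnd (a , b) P) < b)
runEnd-south⇔ a b []      _  = mk⇔ (λ ()) (λ b<b → ⊥-elim (ℤP.<-irrefl refl b<b))
runEnd-south⇔ a b (E ∷ P) _  =
  mk⇔ (λ a∈ → ⊥-elim (ℤP.<⇒≱ (i<i+1 a) (southCols-≥ (a + + 1 , b) P a∈)))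
      (λ b<b → ⊥-elim (ℤP.<-irrefl refl b<b))
runEnd-south⇔ a b (N ∷ P) nu =
  mk⇔ (λ a∈ → ⊥-elim (southCols-climbing a (b + + 1) P nu a∈))
      (λ end<b → ⊥-elim (ℤP.<-asym end<b (ℤP.<-≤-trans (i<i+1 b) (runEnd-climbs (a , b + + 1) P nu))))
runEnd-south⇔ a b (S ∷ P) nu =
  mk⇔ (λ _ → ℤP.≤-<-trans (runEnd-descends (a , b - + 1) P nu) (i-1<i b)) (λ _ → here refl)

-- Invariant while walking along column a: the descent in column a is decided by where the
-- current run ends, those in later columns by the south steps still to come.
DescentProfile-eastFrom : ∀ Sp a h₀ h P → NoUTurns P →
  (Sp a ⇔ proj₂ (runEnd (a , h) P) < h₀) →
  (∀ k → a < k → Sp k ⇔ k ∈ southCols (a , h) P) →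
  DescentProfile Sp a h₀ (eastFrom (a , h) P)
DescentProfile-eastFrom Sp a h₀ h []      _  _       _     = tt
DescentProfile-eastFrom Sp a h₀ h (E ∷ P) nu current later =
  refl , current ,
  DescentProfile-eastFrom Sp (a + + 1) h h P nuP
    (⇔.trans (later (a + + 1) (i<i+1 a)) (runEnd-south⇔ (a + + 1) h P nuP))
    (λ k a+1<k → later k (ℤP.<-trans (i<i+1 a) a+1<k))
  where
  nuP : NoUTurns P
  nuP = Linked.tail nu
DescentProfile-eastFrom Sp a h₀ h (N ∷ P) nu current later =
  DescentProfile-eastFrom Sp a h₀ (h + + 1) P (Linked.tail nu) current later
DescentProfile-eastFrom Sp a h₀ h (S ∷ P) nu current later =
  DescentProfile-eastFrom Sp a h₀ (h - + 1) P (Linked.tail nu) current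
    (λ k a<k → ⇔.trans (later k a<k) (mk⇔ (notHere a<k) there))
  where
  notHere : ∀ {k} → a < k → k ∈ a ∷ southCols (a , h - + 1) P → k ∈ southCols (a , h - + 1) P
  notHere a<k (here k≡a)  = ⊥-elim (ℤP.<-irrefl (sym k≡a) a<k)
  notHere _   (there k∈) = k∈

DescentProfile-eastSteps : ∀ P → SelfAvoiding P →
                           DescentProfile (_∈ southCols origin P) (+ 0) (+ 0) (eastSteps P)
DescentProfile-eastSteps P sa =
  DescentProfile-eastFrom _ (+ 0) (+ 0) (+ 0) P noUTurns (runEnd-south⇔ (+ 0) (+ 0) P noUTurns) (λ _ _ → ⇔.refl)
  where
  noUTurns : NoUTurns P
  noUTurns = selfAvoiding⇒noUTurns origin P sa

data ExactlyOne {A : Set} (P : A → Set) : List A → Set where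
  here  : ∀ {x xs} → P x → All (∁ P) xs → ExactlyOne P (x ∷ xs)
  there : ∀ {x xs} → ¬ P x → ExactlyOne P xs → ExactlyOne P (x ∷ xs)

module _ {A : Set} {P : A → Set} (P? : Decidable P) where

  length-filter≡0⇒All∁ : ∀ xs → length (filter P? xs) ≡ 0 → All (∁ P) xs
  length-filter≡0⇒All∁ []       _     = []
  length-filter≡0⇒All∁ (x ∷ xs) none with P? x
  ... | no ¬px = ¬px ∷ length-filter≡0⇒All∁ xs none

  length-filter≡1⇒ExactlyOne : ∀ xs → length (filter P? xs) ≡ 1 → ExactlyOne P xs
  length-filter≡1⇒ExactlyOne (x ∷ xs) one with P? x
  ... | yes px = here px (length-filter≡0⇒All∁ xs (suc-injective one))
  ... | no ¬px = there ¬px (length-filter≡1⇒ExactlyOne xs one)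

ColumnBounded : (ℤ → ℤ → Set) → List Point → List Point → Set
ColumnBounded _≼_ C = All (λ e → ∀ {c} → c ∈ C → proj₁ c ≡ proj₁ e → proj₂ e ≼ proj₂ c)

-- C: east steps of the boundary touched exactly once; O: those of the boundary never touched.
module Contacts (C O : List Point) where

  Free : Point → Set
  Free p = p ∉ C × p ∉ O

  free? : Decidable Free
  free? p = ¬? (p ∈? C) ×-dec ¬? (p ∈? O)

  freeHeights : List Point → List ℤ
  freeHeights xs = map proj₂ (filter free? xs)

  freeHeights-free : ∀ {p} xs → Free p → freeHeights (p ∷ xs) ≡ proj₂ p ∷ freeHeights xs
  freeHeights-free xs free = cong (map proj₂) (filter-accept free? free)

  freeHeights-contact : ∀ {p} xs → p ∈ C → freeHeights (p ∷ xs) ≡ freeHeights xs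
  freeHeights-contact xs p∈C = cong (map proj₂) (filter-reject free? (λ free → proj₁ free p∈C))

  freeHeights-allFree : ∀ {xs} → All Free xs → freeHeights xs ≡ map proj₂ xs
  freeHeights-allFree allFree = cong (map proj₂) (filter-all free? allFree)

  -- P's contact p meets a free step q of Q; from then on P's free heights lag one column behind Q's.
  NoOvertaking : (ℤ → ℤ → Set) → Set₁
  NoOvertaking _≼_ = ∀ {Sp z p q} xs ys → p ∈ C → Free q → proj₁ p ≡ proj₁ q → proj₂ q ≼ proj₂ p →
    All Free xs → ExactlyOne (_∈ C) ys → All (_∉ O) ys →
    DescentProfile Sp z (proj₂ p) xs → DescentProfile Sp z (proj₂ q) ys →
    freeHeights xs ≡ proj₂ q ∷ freeHeights ys → ColumnBounded _≼_ C xs → ⊥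

  unique-contact : ∀ {_≼_} → (∀ {i j} → i ≼ j → j ≼ i → i ≡ j) → NoOvertaking _≼_ →
    ∀ {Sp z h h′} xs ys → ExactlyOne (_∈ C) xs → ExactlyOne (_∈ C) ys → All (_∉ O) xs → All (_∉ O) ys →
    DescentProfile Sp z h xs → DescentProfile Sp z h′ ys →
    freeHeights xs ≡ freeHeights ys → ColumnBounded _≼_ C xs → ColumnBounded _≼_ C ys → xs ≡ ys
  unique-contact antisym _ (p ∷ xs) (q ∷ ys) (here p∈C ¬Cxs) (here q∈C ¬Cys) (_ ∷ ¬Oxs) (_ ∷ ¬Oys)
                 (colp , _ , px) (colq , _ , qy) heights (bp ∷ _) (bq ∷ _) =
    cong₂ _∷_ p≡q (DescentProfile-heights-injective xs ys px qy (begin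
      map proj₂ xs         ≡⟨ sym (freeHeights-allFree (All.zip (¬Cxs , ¬Oxs))) ⟩
      freeHeights xs       ≡⟨ sym (freeHeights-contact xs p∈C) ⟩
      freeHeights (p ∷ xs) ≡⟨ heights ⟩
      freeHeights (q ∷ ys) ≡⟨ freeHeights-contact ys q∈C ⟩
      freeHeights ys       ≡⟨ freeHeights-allFree (All.zip (¬Cys , ¬Oys)) ⟩
      map proj₂ ys         ∎))
    where
    open ≡-Reasoning
    column : proj₁ q ≡ proj₁ p
    column = trans colq (sym colp)
    p≡q : p ≡ q
    p≡q = cong₂ _,_ (sym column) (antisym (bp q∈C column) (bq p∈C (sym column)))
  unique-contact antisym overtake (p ∷ xs) (q ∷ ys) (there p∉C onex) (there q∉C oney) (p∉O ∷ ¬Oxs) (q∉O ∷ ¬Oys)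
                 (colp , _ , px) (colq , _ , qy) heights (_ ∷ bxs) (_ ∷ bys) =
    cong₂ _∷_ (cong₂ _,_ (trans colp (sym colq)) same-height)
      (unique-contact antisym overtake xs ys onex oney ¬Oxs ¬Oys px qy rest bxs bys)
    where
    heads-and-tails : proj₂ p ≡ proj₂ q × freeHeights xs ≡ freeHeights ys
    heads-and-tails = ∷-injective (trans (sym (freeHeights-free xs (p∉C , p∉O)))
                                         (trans heights (freeHeights-free ys (q∉C , q∉O))))
    same-height : proj₂ p ≡ proj₂ q
    same-height = proj₁ heads-and-tails
    rest : freeHeights xs ≡ freeHeights ys
    rest = proj₂ heads-and-tails
  unique-contact antisym overtake (p ∷ xs) (q ∷ ys) (here p∈C ¬Cxs) (there q∉C oney) (_ ∷ ¬Oxs) (q∉O ∷ ¬Oys)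
                 (colp , _ , px) (colq , _ , qy) heights (_ ∷ bxs) (bq ∷ _) =
    ⊥-elim (overtake xs ys p∈C (q∉C , q∉O) (trans colp (sym colq)) (bq p∈C (trans colp (sym colq)))
              (All.zip (¬Cxs , ¬Oxs)) oney ¬Oys px qy
              (trans (sym (freeHeights-contact xs p∈C)) (trans heights (freeHeights-free ys (q∉C , q∉O)))) bxs)
  unique-contact antisym overtake (p ∷ xs) (q ∷ ys) (there p∉C onex) (here q∈C ¬Cys) (p∉O ∷ ¬Oxs) (_ ∷ ¬Oys)
                 (colp , _ , px) (colq , _ , qy) heights (bp ∷ _) (_ ∷ bys) =
    ⊥-elim (overtake ys xs q∈C (p∉C , p∉O) (trans colq (sym colp)) (bp q∈C (trans colq (sym colp)))
              (All.zip (¬Cys , ¬Oys)) onex ¬Oxs qy px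
              (trans (sym (freeHeights-contact ys q∈C)) (trans (sym heights) (freeHeights-free xs (p∉C , p∉O)))) bys)

  lagging-below : ∀ {Sp z pp qq} xs ys → qq < pp → All Free xs → ExactlyOne (_∈ C) ys → All (_∉ O) ys →
    DescentProfile Sp z pp xs → DescentProfile Sp z qq ys →
    freeHeights xs ≡ qq ∷ freeHeights ys → ColumnBounded _≤_ C xs → ⊥
  lagging-below {pp = pp} {qq} (p ∷ xs) (q ∷ ys) qq<pp (freep ∷ frees) oney (q∉O ∷ ¬Oys)
                (colp , dropP , px) (colq , dropQ , qy) heights (bp ∷ bxs) = continue oney
    where
    heads-and-tails : proj₂ p ≡ qq × freeHeights xs ≡ freeHeights (q ∷ ys)
    heads-and-tails = ∷-injective (trans (sym (freeHeights-free xs freep)) heights)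
    p-at-qq : proj₂ p ≡ qq
    p-at-qq = proj₁ heads-and-tails
    q<qq : proj₂ q < qq
    q<qq = to dropQ (from dropP (subst (_< pp) (sym p-at-qq) qq<pp))
    continue : ExactlyOne (_∈ C) (q ∷ ys) → ⊥
    continue (here q∈C _)     =
      ℤP.<⇒≱ q<qq (subst (_≤ proj₂ q) p-at-qq (bp q∈C (trans colq (sym colp))))
    continue (there q∉C oney′) =
      lagging-below xs ys (subst (proj₂ q <_) (sym p-at-qq) q<qq) frees oney′ ¬Oys px qy
        (trans (proj₂ heads-and-tails) (freeHeights-free ys (q∉C , q∉O))) bxs

  lagging-above : ∀ {Sp z pp qq} xs ys → pp ≤ qq → All Free xs → ExactlyOne (_∈ C) ys → All (_∉ O) ys →
    DescentProfile Sp z pp xs → DescentProfile Sp z qq ys →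
    freeHeights xs ≡ qq ∷ freeHeights ys → ColumnBounded _≥_ C xs → ⊥
  lagging-above {pp = pp} {qq} (p ∷ xs) (q ∷ ys) pp≤qq (freep ∷ frees) oney (q∉O ∷ ¬Oys)
                (colp , dropP , px) (colq , dropQ , qy) heights (bp ∷ bxs) = continue oney
    where
    heads-and-tails : proj₂ p ≡ qq × freeHeights xs ≡ freeHeights (q ∷ ys)
    heads-and-tails = ∷-injective (trans (sym (freeHeights-free xs freep)) heights)
    p-at-qq : proj₂ p ≡ qq
    p-at-qq = proj₁ heads-and-tails
    p≤q : proj₂ p ≤ proj₂ q
    p≤q = subst (_≤ proj₂ q) (sym p-at-qq) (ℤP.≮⇒≥ λ q<qq →
            ℤP.<⇒≱ (subst (_< pp) p-at-qq (to dropP (from dropQ q<qq))) pp≤qq)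
    continue : ExactlyOne (_∈ C) (q ∷ ys) → ⊥
    continue (here q∈C _)     = proj₁ freep (subst (_∈ C) q≡p q∈C)
      where
      column : proj₁ q ≡ proj₁ p
      column = trans colq (sym colp)
      q≡p : q ≡ p
      q≡p = cong₂ _,_ column (ℤP.≤-antisym (bp q∈C column) p≤q)
    continue (there q∉C oney′) =
      lagging-above xs ys p≤q frees oney′ ¬Oys px qy
        (trans (proj₂ heads-and-tails) (freeHeights-free ys (q∉C , q∉O))) bxs

  noOvertaking-below : NoOvertaking _≤_
  noOvertaking-below xs ys p∈C (q∉C , q∉O) column q≤p =
    lagging-below xs ys (ℤP.≤∧≢⇒< q≤p (λ same → q∉C (subst (_∈ C) (cong₂ _,_ column (sym same)) p∈C)))

  noOvertaking-above : NoOvertaking _≥_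
  noOvertaking-above xs ys _ _ _ p≤q = lagging-above xs ys p≤q

freeHeights-swap : ∀ C O xs → Contacts.freeHeights C O xs ≡ Contacts.freeHeights O C xs
freeHeights-swap C O xs = cong (map proj₂) (filter-≐ (Contacts.free? C O) (Contacts.free? O C) (swap , swap) xs)

eastSteps-belowTop : ∀ T P → NEPath T → All (λ p → WeaklyBelowPt p T) (points P) →
                     ColumnBounded _≤_ (eastSteps T) (eastSteps P)
eastSteps-belowTop T P neT below = All.tabulate λ e∈ c∈ column →
  let r , r∈ , same-column , e≤r = find (proj₁ (All.lookup below (eastFrom⊆scanl origin P e∈))) in
  ℤP.≤-trans e≤r (NEPath-column≤eastStep origin T neT c∈ r∈ (trans same-column (sym column)))

eastSteps-aboveBottom : ∀ B P → NEPath B → All (λ p → WeaklyAbovePt p B) (points P) →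
                        ColumnBounded _≥_ (eastSteps B) (eastSteps P)
eastSteps-aboveBottom B P neB above = All.tabulate λ e∈ c∈ column →
  let r , r∈ , next-column , r≤e = find (proj₁ (All.lookup above (move-E-eastFrom∈scanl origin P e∈))) in
  ℤP.≤-trans (NEPath-eastStep≤nextColumn origin B neB c∈ r∈ (trans next-column (cong (_+ + 1) (sym column)))) r≤e

atColumns : Pred ℕ 0ℓ → ℤ → Set
atColumns D (+ k)    = D k
atColumns D -[1+ _ ] = ⊥

southCols⇔atColumns : ∀ P D → HasDescentSet P D → ∀ z → z ∈ southCols origin P ⇔ atColumns D z
southCols⇔atColumns P D descents (+ k)    = descents k
southCols⇔atColumns P D descents -[1+ _ ] = mk⇔ (λ z∈ → ℤP.<⇒≱ -<+ (southCols-≥ origin P z∈)) (λ ())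

module _ {T B : Path} {x y : ℕ} {D : Pred ℕ 0ℓ} {H : List ℤ} where

  eastSteps-injective : ∀ {P Q} → InP̃DH T B x y D H P → InP̃DH T B x y D H Q →
                        eastSteps P ≡ eastSteps Q → P ≡ Q
  eastSteps-injective {P} {Q} ((endP , saP , _) , _) ((endQ , saQ , _) , _) east =
    eastFrom-foldl-injective origin P Q saP saQ east (trans endP (sym endQ))

  DescentProfile-InP̃DH : ∀ {P} → InP̃DH T B x y D H P →
                          DescentProfile (atColumns D) (+ 0) (+ 0) (eastSteps P)
  DescentProfile-InP̃DH {P} ((_ , saP , _) , descents , _) =
    DescentProfile-resp (southCols⇔atColumns P D descents) (eastSteps P) (DescentProfile-eastSteps P saP)

  unique-topContact : NEPath T → ∀ {P Q} →
    InP̃DH T B x y D H P → t T P ≡ 1 → b B P ≡ 0 →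
    InP̃DH T B x y D H Q → t T Q ≡ 1 → b B Q ≡ 0 → P ≡ Q
  unique-topContact neT {P} {Q} inP@((_ , _ , bandP) , _ , hP) tP bP inQ@((_ , _ , bandQ) , _ , hQ) tQ bQ =
    eastSteps-injective inP inQ
      (unique-contact ℤP.≤-antisym noOvertaking-below (eastSteps P) (eastSteps Q)
        (length-filter≡1⇒ExactlyOne (_∈? eastSteps T) _ tP) (length-filter≡1⇒ExactlyOne (_∈? eastSteps T) _ tQ)
        (length-filter≡0⇒All∁ (_∈? eastSteps B) _ bP) (length-filter≡0⇒All∁ (_∈? eastSteps B) _ bQ)
        (DescentProfile-InP̃DH inP) (DescentProfile-InP̃DH inQ) (trans hP (sym hQ))
        (eastSteps-belowTop T P neT (All.map proj₁ bandP)) (eastSteps-belowTop T Q neT (All.map proj₁ bandQ)))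
    where open Contacts (eastSteps T) (eastSteps B)

  unique-bottomContact : NEPath B → ∀ {P Q} →
    InP̃DH T B x y D H P → t T P ≡ 0 → b B P ≡ 1 →
    InP̃DH T B x y D H Q → t T Q ≡ 0 → b B Q ≡ 1 → P ≡ Q
  unique-bottomContact neB {P} {Q} inP@((_ , _ , bandP) , _ , hP) tP bP inQ@((_ , _ , bandQ) , _ , hQ) tQ bQ =
    eastSteps-injective inP inQ
      (unique-contact (flip ℤP.≤-antisym) noOvertaking-above (eastSteps P) (eastSteps Q)
        (length-filter≡1⇒ExactlyOne (_∈? eastSteps B) _ bP) (length-filter≡1⇒ExactlyOne (_∈? eastSteps B) _ bQ)
        (length-filter≡0⇒All∁ (_∈? eastSteps T) _ tP) (length-filter≡0⇒All∁ (_∈? eastSteps T) _ tQ)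
        (DescentProfile-InP̃DH inP) (DescentProfile-InP̃DH inQ)
        (trans (sym (freeHeights-swap (eastSteps T) (eastSteps B) (eastSteps P)))
          (trans (trans hP (sym hQ)) (freeHeights-swap (eastSteps T) (eastSteps B) (eastSteps Q))))
        (eastSteps-aboveBottom B P neB (All.map proj₂ bandP)) (eastSteps-aboveBottom B Q neB (All.map proj₂ bandQ)))
    where open Contacts (eastSteps B) (eastSteps T)

proposition3p9 : (x y : ℕ) (T B : Path) →
    NEPath T → endpoint T ≡ (+ x , + y) →
    NEPath B → endpoint B ≡ (+ x , + y) →
    WeaklyAbove T B →
    (D : Pred ℕ 0ℓ) (H : List ℤ) →
    ((P₁ Q₁ : Path) →
      InP̃DH T B x y D H P₁ → t T P₁ ≡ 1 → b B P₁ ≡ 0 →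
      InP̃DH T B x y D H Q₁ → t T Q₁ ≡ 1 → b B Q₁ ≡ 0 →
      P₁ ≡ Q₁)
    ×
    ((P₂ Q₂ : Path) →
      InP̃DH T B x y D H P₂ → t T P₂ ≡ 0 → b B P₂ ≡ 1 →
      InP̃DH T B x y D H Q₂ → t T Q₂ ≡ 0 → b B Q₂ ≡ 1 →
      P₂ ≡ Q₂)
proposition3p9 x y T B neT _ neB _ _ D H =
  (λ _ _ → unique-topContact neT) , (λ _ _ → unique-bottomContact neB)
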